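{- For every integer $n>0$, $\mathrm{DE2}(n)+\mathrm{DE2}(n-3)$ equals the number of partitions of $n$ into parts each of which is greater than $1$ and not divisible by $4$.
   Context: For a nonnegative integer $k$, $\mathrm{DE2}(k)$ denotes the number of partitions of $k$ in which no even part is repeated, and the largest part is odd and appears at least twice (so $\mathrm{DE2}(0)=0$); set $\mathrm{DE2}(k)=0$ for $k<0$. Equivalently, $\sum_{k\ge 0}\mathrm{DE2}(k)q^k=\sum_{n\ge 0}\frac{(-q^2;q^2)_n q^{4n+2}}{(q;q^2)_{n+1}}$, where $(a;q)_n=\prod_{j=0}^{n-1}(1-aq^j)$. -}

module Defs where

open import Data.Nat using (ℕ; zero; suc; _+_; _*_; _∸_; _≤_; _<_; _≟_; _≤?_; _<?_)
open import Data.Nat.Divisibility using (_∣_; _∣?_)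
open import Data.List using (List; []; _∷_; length; filter; concatMap; sum; map; upTo)
open import Data.List.Relation.Unary.All using (All)
open import Data.List.Relation.Unary.All as All using (all?)
open import Data.List.Relation.Unary.AllPairs using (AllPairs)
open import Data.Product using (_×_; _,_)
open import Relation.Nullary using (¬_; Dec; yes; no)
open import Relation.Nullary.Decidable using (_×-dec_; ¬?; _→-dec_)
open import Relation.Binary.PropositionalEquality using (_≡_)
open import Data.Sum using (_⊎_)

-- A partition is a list of positive parts in nonincreasing order.
-- partitionsMax m n : all nonincreasing lists of positive naturals,
-- each part ≤ m, summing to n.  Defined by recursion on a fuel
-- parameter (n itself suffices: every part is ≥ 1).
partsFuel : ℕ → ℕ → ℕ → List (List ℕ)
partsFuel _        _ zero    = [] ∷ []
partsFuel zero     _ (suc n) = []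
partsFuel (suc f)  m (suc n) =
  concatMap (λ k → map (suc k ∷_) (partsFuel f (suc k) (suc n ∸ suc k)))
            (filter (λ k → suc k ≤? m) (upTo (suc n)))

partitions : ℕ → List (List ℕ)
partitions n = partsFuel n n n

count : ℕ → List ℕ → ℕ
count k []      = 0
count k (x ∷ xs) with k ≟ x
... | yes _ = suc (count k xs)
... | no  _ = count k xs

Even : ℕ → Set
Even k = 2 ∣ k

IsDE2 : List ℕ → Set
IsDE2 []        = 0 ≡ 1   -- the empty partition has no largest part
IsDE2 (l ∷ ps)  = All (λ k → Even k → count k (l ∷ ps) ≤ 1) (l ∷ ps)
                × ¬ Even l
                × 2 ≤ count l (l ∷ ps)

isDE2? : (p : List ℕ) → Dec (IsDE2 p)
isDE2? []       = 0 ≟ 1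
isDE2? (l ∷ ps) =
  all? (λ k → (2 ∣? k) →-dec (count k (l ∷ ps) ≤? 1)) (l ∷ ps)
  ×-dec ¬? (2 ∣? l)
  ×-dec (2 ≤? count l (l ∷ ps))

DE2 : ℕ → ℕ
DE2 k = length (filter isDE2? (partitions k))

DE2-sub3 : ℕ → ℕ
DE2-sub3 n with n <? 3
... | yes _ = 0
... | no  _ = DE2 (n ∸ 3)

GoodParts : List ℕ → Set
GoodParts = All (λ k → 1 < k × ¬ (4 ∣ k))

goodParts? : (p : List ℕ) → Dec (GoodParts p)
goodParts? = all? (λ k → (1 <? k) ×-dec ¬? (4 ∣? k))

P-gt1-not4 : ℕ → ℕ
P-gt1-not4 n = length (filter goodParts? (partitions n))

module Submission where

-- Let Aₖ, Gₖ and Dₖ count, by size, the partitions with parts ≤ k that respectively have no repeated even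
-- part, have every part > 1 and not divisible by 4, and are DE2 partitions. Removing the largest part gives
-- (1 − qᵏ)Aₖ = Aₖ₋₁ for odd k and Aₖ = (1 + qᵏ)Aₖ₋₁ for even k; (1 − qᵏ)Gₖ = Gₖ₋₁ or Gₖ = Gₖ₋₁ according
-- as k is an allowed part; and Dₖ = Dₖ₋₁ + q²ᵏAₖ for odd k, Dₖ = Dₖ₋₁ for even k.
-- For odd o these recurrences give (1 − q + q^(o+1) + q^(2o+3))A_o = 1 + (1 + q³)D_o, by induction in steps
-- of two after cancelling a factor 1 + q^(o+1). For K = 4j + 1, multiplying (1 − q)A_K and G_K by
-- (1 − q)⋯(1 − q^K) yields (1 − q)(1 − q⁴)⋯(1 − q^(8j)) and (1 − q)(1 − q⁴)⋯(1 − q^(4j)) (Euler's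
-- argument), which agree below degree 4j + 4; so (1 − q)A_K ≡ G_K and hence (1 + q³)D_K ≡ G_K − 1 modulo
-- q^(K+1). For 0 < n ≤ K the coefficients of qⁿ in D_K and G_K are DE2(n) and the right-hand count.

module PowerSeries where
  open import Data.Nat as ℕ using (ℕ; zero; suc; _≤_; _<_; s≤s; _∸_)
  import Data.Nat.Properties as ℕₚ
  open import Data.Nat.Induction using (<-rec)
  open import Data.Integer using (ℤ; +_; _+_; _-_; -_)
  import Data.Integer.Properties as ℤₚ
  open import Algebra.Properties.AbelianGroup ℤₚ.+-0-abelianGroup using (∙-cancelʳ)
  open import Relation.Binary using (Setoid)
  open import Relation.Binary.PropositionalEquality
  import Relation.Binary.Reasoning.Setoid

  Series : Set
  Series = ℕ → ℤ

  infix 4 _≈_ _≈[_]_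
  _≈_ : Series → Series → Set
  f ≈ g = ∀ n → f n ≡ g n

  _≈[_]_ : Series → ℕ → Series → Set
  f ≈[ L ] g = ∀ n → n ≤ L → f n ≡ g n

  ≈-setoid : Setoid _ _
  ≈-setoid = record
    { Carrier       = Series
    ; _≈_           = _≈_
    ; isEquivalence = record
      { refl  = λ _ → refl
      ; sym   = λ f≈g n → sym (f≈g n)
      ; trans = λ f≈g g≈h n → trans (f≈g n) (g≈h n)
      }
    }

  open Setoid ≈-setoid public using () renaming (refl to ≈-refl; trans to ≈-trans)
  module ≈-Reasoning = Relation.Binary.Reasoning.Setoid ≈-setoid

  0ₛ δ : Series
  0ₛ _ = + 0
  δ zero    = + 1
  δ (suc _) = + 0

  -- shift k s is qᵏ · s
  shift : ℕ → Series → Series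
  shift zero    s n       = s n
  shift (suc k) s zero    = + 0
  shift (suc k) s (suc n) = shift k s n

  infixl 6 _⊕_ _⊖_
  _⊕_ _⊖_ : Series → Series → Series
  (f ⊕ g) n = f n + g n
  (f ⊖ g) n = f n - g n

  ⊕-cong : ∀ {f f′ g g′} → f ≈ f′ → g ≈ g′ → f ⊕ g ≈ f′ ⊕ g′
  ⊕-cong f≈f′ g≈g′ n = cong₂ _+_ (f≈f′ n) (g≈g′ n)

  shift-⊕ : ∀ k f g → shift k (f ⊕ g) ≈ shift k f ⊕ shift k g
  shift-⊕ zero    f g n       = refl
  shift-⊕ (suc k) f g zero    = refl
  shift-⊕ (suc k) f g (suc n) = shift-⊕ k f g n

  shift-⊖ : ∀ k f g → shift k (f ⊖ g) ≈ shift k f ⊖ shift k g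
  shift-⊖ zero    f g n       = refl
  shift-⊖ (suc k) f g zero    = refl
  shift-⊖ (suc k) f g (suc n) = shift-⊖ k f g n

  shift-cong : ∀ k {f g} → f ≈ g → shift k f ≈ shift k g
  shift-cong zero    f≈g n       = f≈g n
  shift-cong (suc k) f≈g zero    = refl
  shift-cong (suc k) f≈g (suc n) = shift-cong k f≈g n

  shift-+ : ∀ a b f → shift a (shift b f) ≈ shift (a ℕ.+ b) f
  shift-+ zero    b f n       = refl
  shift-+ (suc a) b f zero    = refl
  shift-+ (suc a) b f (suc n) = shift-+ a b f n

  shift-0ₛ : ∀ k → shift k 0ₛ ≈ 0ₛ
  shift-0ₛ zero    n       = refl
  shift-0ₛ (suc k) zero    = refl
  shift-0ₛ (suc k) (suc n) = shift-0ₛ k n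

  shift-below : ∀ k s {n} → n < k → shift k s n ≡ + 0
  shift-below (suc k) s {zero}  _         = refl
  shift-below (suc k) s {suc n} (s≤s n<k) = shift-below k s n<k

  shift-above : ∀ k s {n} → k ≤ n → shift k s n ≡ s (n ∸ k)
  shift-above zero    s _         = refl
  shift-above (suc k) s (s≤s k≤n) = shift-above k s k≤n

  shift-local : ∀ k {f g} n → (∀ m → m ≤ n → f m ≡ g m) → shift k f n ≡ shift k g n
  shift-local zero    n       f≗g = f≗g n ℕₚ.≤-refl
  shift-local (suc k) zero    f≗g = refl
  shift-local (suc k) (suc n) f≗g = shift-local k n (λ m m≤n → f≗g m (ℕₚ.m≤n⇒m≤1+n m≤n))

  shift-local< : ∀ k {f g} n → (∀ m → m < n → f m ≡ g m) → shift (suc k) f n ≡ shift (suc k) g n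
  shift-local< k zero    f≗g = refl
  shift-local< k (suc n) f≗g = shift-local k n (λ m m≤n → f≗g m (s≤s m≤n))

  ≈[]-by-<-induction : ∀ L {f g} → (∀ n → n ≤ L → (∀ m → m < n → f m ≡ g m) → f n ≡ g n) → f ≈[ L ] g
  ≈[]-by-<-induction L {f} {g} step = <-rec (λ n → n ≤ L → f n ≡ g n)
    (λ n rec n≤L → step n n≤L (λ m m<n → rec m<n (ℕₚ.≤-trans (ℕₚ.<⇒≤ m<n) n≤L)))

  ⊕-shift-cancel : ∀ k L {f g} → f ⊕ shift (suc k) f ≈[ L ] g ⊕ shift (suc k) g → f ≈[ L ] g
  ⊕-shift-cancel k L {f} {g} eq = ≈[]-by-<-induction L λ n n≤L below →
    ∙-cancelʳ (shift (suc k) f n) (f n) (g n)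
      (trans (eq n n≤L) (cong (λ x → g n + x) (sym (shift-local< k n below))))

  ⊖-shift-cancel : ∀ k L {f g} → f ⊖ shift (suc k) f ≈[ L ] g ⊖ shift (suc k) g → f ≈[ L ] g
  ⊖-shift-cancel k L {f} {g} eq = ≈[]-by-<-induction L λ n n≤L below →
    ∙-cancelʳ (- shift (suc k) f n) (f n) (g n)
      (trans (eq n n≤L) (cong (λ x → g n - x) (sym (shift-local< k n below))))

module Arithmetic where
  open import Defs using (Even)
  open import Function.Base using (_∘_)
  open import Data.Nat as ℕ using (ℕ; zero; suc; _≤_; _<_; z≤n; s≤s)
  import Data.Nat.Properties as ℕₚ
  open import Data.Nat.Divisibility using (_∣_; divides; ∣m+n∣m⇒∣n; ∣⇒≤; ∣1⇒≡1)
  open import Data.Product using (_×_; _,_)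
  open import Relation.Nullary using (¬_)
  open import Relation.Binary.PropositionalEquality

  double : ℕ → ℕ
  double zero    = zero
  double (suc m) = suc (suc (double m))

  quad : ℕ → ℕ
  quad j = double (double j)

  double≡+ : ∀ m → double m ≡ m ℕ.+ m
  double≡+ zero    = refl
  double≡+ (suc m) = cong suc (trans (cong suc (double≡+ m)) (sym (ℕₚ.+-suc m m)))

  double≡*2 : ∀ m → double m ≡ m ℕ.* 2
  double≡*2 zero    = refl
  double≡*2 (suc m) = cong (λ d → suc (suc d)) (double≡*2 m)

  double-mono-≤ : ∀ {m n} → m ≤ n → double m ≤ double n
  double-mono-≤ z≤n       = z≤n
  double-mono-≤ (s≤s m≤n) = s≤s (s≤s (double-mono-≤ m≤n))

  quad-mono-≤ : ∀ {m n} → m ≤ n → quad m ≤ quad n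
  quad-mono-≤ = double-mono-≤ ∘ double-mono-≤

  n≤double : ∀ n → n ≤ double n
  n≤double n = subst (n ≤_) (sym (double≡+ n)) (ℕₚ.m≤m+n n n)

  n≤quad : ∀ n → n ≤ quad n
  n≤quad n = ℕₚ.≤-trans (n≤double n) (double-mono-≤ (n≤double n))

  GoodPart : ℕ → Set
  GoodPart k = 1 < k × ¬ 4 ∣ k

  even-double : ∀ m → Even (double m)
  even-double m = divides m (double≡*2 m)

  odd-suc-double : ∀ m → ¬ Even (suc (double m))
  odd-suc-double m 2∣ = ℕₚ.1+n≢n (∣1⇒≡1 (∣m+n∣m⇒∣n 2∣′ (even-double m)))
    where 2∣′ = subst (2 ∣_) (ℕₚ.+-comm 1 (double m)) 2∣

  4∣quad : ∀ j → 4 ∣ quad j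
  4∣quad j = divides j (trans (double≡*2 (double j)) (trans (cong (ℕ._* 2) (double≡*2 j)) (ℕₚ.*-assoc j 2 2)))

  ¬4∣r+quad : ∀ r j → 0 < r → r < 4 → ¬ 4 ∣ r ℕ.+ quad j
  ¬4∣r+quad r j 0<r r<4 4∣ = ℕₚ.<⇒≱ r<4 (∣⇒≤ {{ℕ.>-nonZero 0<r}} 4∣r)
    where 4∣r = ∣m+n∣m⇒∣n (subst (4 ∣_) (ℕₚ.+-comm r (quad j)) 4∣) (4∣quad j)

  ¬good-1 : ¬ GoodPart 1
  ¬good-1 (1<1 , _) = ℕₚ.n≮n 1 1<1

  good-2+quad : ∀ j → GoodPart (2 ℕ.+ quad j)
  good-2+quad j = s≤s (s≤s z≤n) , ¬4∣r+quad 2 j (s≤s z≤n) (s≤s (s≤s (s≤s z≤n)))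

  good-3+quad : ∀ j → GoodPart (3 ℕ.+ quad j)
  good-3+quad j = s≤s (s≤s z≤n) , ¬4∣r+quad 3 j (s≤s z≤n) (s≤s (s≤s (s≤s (s≤s z≤n))))

  ¬good-4+quad : ∀ j → ¬ GoodPart (4 ℕ.+ quad j)
  ¬good-4+quad j (_ , ¬4∣) = ¬4∣ (4∣quad (suc j))

  good-5+quad : ∀ j → GoodPart (5 ℕ.+ quad j)
  good-5+quad j = s≤s (s≤s z≤n) , ¬4∣r+quad 1 (suc j) (s≤s z≤n) (s≤s (s≤s z≤n))


module Products where
  open import Data.Nat as ℕ using (ℕ; zero; suc; _<_; s≤s)
  import Data.Nat.Properties as ℕₚ
  open import Data.Integer using (_+_; _-_)
  import Data.Integer.Properties as ℤₚ
  open import Data.Integer.Tactic.RingSolver using (solve-∀)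
  open import Algebra.Properties.AbelianGroup ℤₚ.+-0-abelianGroup using (//-rightDividesʳ)
  open import Relation.Binary.PropositionalEquality
  open PowerSeries
  open Arithmetic using (double; quad; double≡+; quad-mono-≤)

  oneMinusQ : ℕ → Series → Series
  oneMinusQ k s = s ⊖ shift k s

  oneMinusQ-cong : ∀ k {f g} → f ≈ g → oneMinusQ k f ≈ oneMinusQ k g
  oneMinusQ-cong k f≈g n = cong₂ _-_ (f≈g n) (shift-cong k f≈g n)

  oneMinusQ-cong≤ : ∀ k L {f g} → f ≈[ L ] g → oneMinusQ k f ≈[ L ] oneMinusQ k g
  oneMinusQ-cong≤ k L f≈g n n≤L =
    cong₂ _-_ (f≈g n n≤L) (shift-local k n (λ m m≤n → f≈g m (ℕₚ.≤-trans m≤n n≤L)))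

  oneMinusQ-comm : ∀ a b s → oneMinusQ a (oneMinusQ b s) ≈ oneMinusQ b (oneMinusQ a s)
  oneMinusQ-comm a b s n = begin
    s n - shift b s n - shift a (s ⊖ shift b s) n
      ≡⟨ cong (λ x → s n - shift b s n - x) (shift-⊖ a s (shift b s) n) ⟩
    s n - shift b s n - (shift a s n - shift a (shift b s) n)
      ≡⟨ cong (λ x → s n - shift b s n - (shift a s n - x)) (shift-exchange a b) ⟩
    s n - shift b s n - (shift a s n - shift b (shift a s) n)
      ≡⟨ swap (s n) (shift b s n) (shift a s n) _ ⟩
    s n - shift a s n - (shift b s n - shift b (shift a s) n)
      ≡⟨ cong (λ x → s n - shift a s n - x) (shift-⊖ b s (shift a s) n) ⟨
    s n - shift a s n - shift b (s ⊖ shift a s) n ∎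
    where
    open ≡-Reasoning
    shift-exchange : ∀ a b → shift a (shift b s) n ≡ shift b (shift a s) n
    shift-exchange a b = trans (shift-+ a b s n)
      (trans (cong (λ e → shift e s n) (ℕₚ.+-comm a b)) (sym (shift-+ b a s n)))
    swap : ∀ x y z w → x - y - (z - w) ≡ x - z - (y - w)
    swap = solve-∀

  oneMinusQ-onePlusQ : ∀ e s → oneMinusQ e (s ⊕ shift e s) ≈ oneMinusQ (double e) s
  oneMinusQ-onePlusQ e s n = begin
    s n + shift e s n - shift e (s ⊕ shift e s) n
      ≡⟨ cong (λ x → s n + shift e s n - x) (shift-⊕ e s (shift e s) n) ⟩
    s n + shift e s n - (shift e s n + shift e (shift e s) n)
      ≡⟨ cancel (s n) (shift e s n) _ ⟩
    s n - shift e (shift e s) n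
      ≡⟨ cong (λ x → s n - x) (trans (shift-+ e e s n) (cong (λ d → shift d s n) (sym (double≡+ e)))) ⟩
    s n - shift (double e) s n ∎
    where
    open ≡-Reasoning
    cancel : ∀ x y z → x + y - (y + z) ≡ x - z
    cancel = solve-∀

  oneMinusQ-below : ∀ k s L → L < k → oneMinusQ k s ≈[ L ] s
  oneMinusQ-below k s L L<k n n≤L =
    trans (cong (s n -_) (shift-below k s (ℕₚ.≤-<-trans n≤L L<k))) (ℤₚ.+-identityʳ (s n))

  oneMinusQ-inverts : ∀ k {f} g → f ≈ g ⊕ shift k f → oneMinusQ k f ≈ g
  oneMinusQ-inverts k {f} g f≈ n =
    trans (cong (_- shift k f n) (f≈ n)) (//-rightDividesʳ (shift k f n) (g n))

  ∏oneMinusQ : ℕ → Series → Series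
  ∏oneMinusQ zero    s = s
  ∏oneMinusQ (suc K) s = ∏oneMinusQ K (oneMinusQ (suc K) s)

  ∏oneMinusQ-cong : ∀ K {f g} → f ≈ g → ∏oneMinusQ K f ≈ ∏oneMinusQ K g
  ∏oneMinusQ-cong zero    f≈g = f≈g
  ∏oneMinusQ-cong (suc K) f≈g = ∏oneMinusQ-cong K (oneMinusQ-cong (suc K) f≈g)

  ∏oneMinusQ-oneMinusQ : ∀ K a s → ∏oneMinusQ K (oneMinusQ a s) ≈ oneMinusQ a (∏oneMinusQ K s)
  ∏oneMinusQ-oneMinusQ zero    a s = ≈-refl
  ∏oneMinusQ-oneMinusQ (suc K) a s = ≈-trans
    (∏oneMinusQ-cong K (oneMinusQ-comm (suc K) a s))
    (∏oneMinusQ-oneMinusQ K a (oneMinusQ (suc K) s))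

  ∏oneMinusQ-cancel : ∀ K L {f g} → ∏oneMinusQ K f ≈[ L ] ∏oneMinusQ K g → f ≈[ L ] g
  ∏oneMinusQ-cancel zero    L eq = eq
  ∏oneMinusQ-cancel (suc K) L eq = ⊖-shift-cancel K L (∏oneMinusQ-cancel K L eq)

  ∏oneMinusQ-inverts : ∀ K {f} g → f ≈ g ⊕ shift (suc K) f → ∏oneMinusQ (suc K) f ≈ ∏oneMinusQ K g
  ∏oneMinusQ-inverts K g f≈ = ∏oneMinusQ-cong K (oneMinusQ-inverts (suc K) g f≈)

  euler4 : ℕ → Series
  euler4 zero    = δ
  euler4 (suc j) = oneMinusQ (4 ℕ.+ quad j) (euler4 j)

  euler4-stable : ∀ j d → euler4 (d ℕ.+ j) ≈[ suc (quad j) ] euler4 j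
  euler4-stable j zero    = λ _ _ → refl
  euler4-stable j (suc d) n n≤ = trans
    (oneMinusQ-below _ (euler4 (d ℕ.+ j)) (suc (quad j))
      (s≤s (s≤s (ℕₚ.≤-trans (quad-mono-≤ (ℕₚ.m≤n+m j d)) (ℕₚ.m≤n+m _ 2))))
      n n≤)
    (euler4-stable j d n n≤)

open import Defs using (Even)
open import Data.Nat using (ℕ; suc)
open import Relation.Nullary using (¬_)
open PowerSeries using (Series; _≈_; δ; _⊕_; shift)

module GeneratingFunctions
  (A      : ℕ → Series)
  (A-zero : A 0 ≈ δ)
  (A-odd  : ∀ k → ¬ Even (suc k) → A (suc k) ≈ A k ⊕ shift (suc k) (A (suc k)))
  (A-even : ∀ k → Even (suc k) → A (suc k) ≈ A k ⊕ shift (suc k) (A k))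
  where
  open import Data.Nat as ℕ using (zero; _<_; s≤s)
  open import Relation.Binary.PropositionalEquality
  open PowerSeries
  open Arithmetic
  open Products

  A-odd-double : ∀ m → A (suc (double m)) ≈ A (double m) ⊕ shift (suc (double m)) (A (suc (double m)))
  A-odd-double m = A-odd (double m) (odd-suc-double m)

  A-even-double : ∀ m → A (double (suc m)) ≈ A (suc (double m)) ⊕ shift (double (suc m)) (A (suc (double m)))
  A-even-double m = A-even (suc (double m)) (even-double (suc m))

  ∏A-even : ∀ m → ∏oneMinusQ (double m) (A (double m)) ≈ euler4 m
  ∏A-odd  : ∀ m → ∏oneMinusQ (suc (double m)) (A (suc (double m))) ≈ euler4 m

  ∏A-even zero    = A-zero
  ∏A-even (suc m) = begin
    ∏oneMinusQ (suc d) (A e)                     ≈⟨ ∏oneMinusQ-cong d (oneMinusQ-cong e (A-even-double m)) ⟩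
    ∏oneMinusQ d (oneMinusQ e (A d ⊕ shift e (A d))) ≈⟨ ∏oneMinusQ-cong d (oneMinusQ-onePlusQ e (A d)) ⟩
    ∏oneMinusQ d (oneMinusQ (double e) (A d))    ≈⟨ ∏oneMinusQ-oneMinusQ d (double e) (A d) ⟩
    oneMinusQ (double e) (∏oneMinusQ d (A d))    ≈⟨ oneMinusQ-cong (double e) (∏A-odd m) ⟩
    euler4 (suc m)                               ∎
    where
    open ≈-Reasoning
    d = suc (double m)
    e = double (suc m)

  ∏A-odd m = ≈-trans (∏oneMinusQ-inverts (double m) (A (double m)) (A-odd-double m)) (∏A-even m)

  module Euler
    (G      : ℕ → Series)
    (G-zero : G 0 ≈ δ)
    (G-good : ∀ k → GoodPart (suc k) → G (suc k) ≈ G k ⊕ shift (suc k) (G (suc k)))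
    (G-bad  : ∀ k → ¬ GoodPart (suc k) → G (suc k) ≈ G k)
    where

    ∏G : ∀ j → ∏oneMinusQ (suc (quad j)) (G (suc (quad j))) ≈ oneMinusQ 1 (euler4 j)
    ∏G zero    = oneMinusQ-cong 1 (≈-trans (G-bad 0 ¬good-1) G-zero)
    ∏G (suc j) = begin
      ∏oneMinusQ (5 ℕ.+ Q) (G (5 ℕ.+ Q))
        ≈⟨ ∏oneMinusQ-inverts (4 ℕ.+ Q) (G (4 ℕ.+ Q)) (G-good (4 ℕ.+ Q) (good-5+quad j)) ⟩
      ∏oneMinusQ (3 ℕ.+ Q) (oneMinusQ (4 ℕ.+ Q) (G (4 ℕ.+ Q)))
        ≈⟨ ∏oneMinusQ-cong (3 ℕ.+ Q) (oneMinusQ-cong (4 ℕ.+ Q) (G-bad (3 ℕ.+ Q) (¬good-4+quad j))) ⟩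
      ∏oneMinusQ (3 ℕ.+ Q) (oneMinusQ (4 ℕ.+ Q) (G (3 ℕ.+ Q)))
        ≈⟨ ∏oneMinusQ-oneMinusQ (3 ℕ.+ Q) (4 ℕ.+ Q) (G (3 ℕ.+ Q)) ⟩
      oneMinusQ (4 ℕ.+ Q) (∏oneMinusQ (3 ℕ.+ Q) (G (3 ℕ.+ Q)))
        ≈⟨ oneMinusQ-cong (4 ℕ.+ Q)
             (∏oneMinusQ-inverts (2 ℕ.+ Q) (G (2 ℕ.+ Q)) (G-good (2 ℕ.+ Q) (good-3+quad j))) ⟩
      oneMinusQ (4 ℕ.+ Q) (∏oneMinusQ (2 ℕ.+ Q) (G (2 ℕ.+ Q)))
        ≈⟨ oneMinusQ-cong (4 ℕ.+ Q)
             (∏oneMinusQ-inverts (1 ℕ.+ Q) (G (1 ℕ.+ Q)) (G-good (1 ℕ.+ Q) (good-2+quad j))) ⟩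
      oneMinusQ (4 ℕ.+ Q) (∏oneMinusQ (1 ℕ.+ Q) (G (1 ℕ.+ Q)))
        ≈⟨ oneMinusQ-cong (4 ℕ.+ Q) (∏G j) ⟩
      oneMinusQ (4 ℕ.+ Q) (oneMinusQ 1 (euler4 j))
        ≈⟨ oneMinusQ-comm (4 ℕ.+ Q) 1 (euler4 j) ⟩
      oneMinusQ 1 (euler4 (suc j)) ∎
      where
      open ≈-Reasoning
      Q = quad j

    -- Multiplied by (1 − q)⋯(1 − q^K), the two sides become (1 − q) · euler4 (2j) and (1 − q) · euler4 j,
    -- which agree up to degree K.
    oneMinusQ-A≈G : ∀ j → oneMinusQ 1 (A (suc (quad j))) ≈[ suc (quad j) ] G (suc (quad j))
    oneMinusQ-A≈G j = ∏oneMinusQ-cancel K K λ n n≤K → begin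
      ∏oneMinusQ K (oneMinusQ 1 (A K)) n  ≡⟨ ∏oneMinusQ-oneMinusQ K 1 (A K) n ⟩
      oneMinusQ 1 (∏oneMinusQ K (A K)) n  ≡⟨ oneMinusQ-cong 1 (∏A-odd (double j)) n ⟩
      oneMinusQ 1 (euler4 (double j)) n   ≡⟨ oneMinusQ-cong≤ 1 K euler4-double n n≤K ⟩
      oneMinusQ 1 (euler4 j) n            ≡⟨ ∏G j n ⟨
      ∏oneMinusQ K (G K) n                ∎
      where
      open ≡-Reasoning
      K = suc (quad j)
      euler4-double : euler4 (double j) ≈[ K ] euler4 j
      euler4-double n n≤K = trans (cong (λ i → euler4 i n) (double≡+ j)) (euler4-stable j j n n≤K)

  module Telescoping
    (D      : ℕ → Series)
    (D-zero : D 0 ≈ 0ₛ)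
    (D-odd  : ∀ k → ¬ Even (suc k) → D (suc k) ≈ D k ⊕ shift (suc k ℕ.+ suc k) (A (suc k)))
    (D-even : ∀ k → Even (suc k) → D (suc k) ≈ D k)
    where
    import Data.Nat.Tactic.RingSolver as ℕ-Solver
    open import Data.Integer using (ℤ; +_; _+_; _-_)
    import Data.Nat.Properties as ℕₚ
    import Data.Integer.Properties as ℤₚ
    open import Data.Integer.Tactic.RingSolver using (solve-∀)

    -- tele o s is (1 − q + q^(o+1) + q^(2o+3)) · s
    tele : ℕ → Series → Series
    tele o s = s ⊖ shift 1 s ⊕ shift (suc o) s ⊕ shift (3 ℕ.+ (o ℕ.+ o)) s

    tele-low : ∀ o s → tele o s ≈[ o ] oneMinusQ 1 s
    tele-low o s n n≤o = begin
      s n - shift 1 s n + shift (suc o) s n + shift (3 ℕ.+ (o ℕ.+ o)) s n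
        ≡⟨ cong₂ (λ c d → s n - shift 1 s n + c + d)
                 (shift-below (suc o) s (s≤s n≤o)) (shift-below (3 ℕ.+ (o ℕ.+ o)) s n<3+2o) ⟩
      s n - shift 1 s n + + 0 + + 0
        ≡⟨ trans (ℤₚ.+-identityʳ _) (ℤₚ.+-identityʳ _) ⟩
      s n - shift 1 s n ∎
      where
      open ≡-Reasoning
      n<3+2o : n < 3 ℕ.+ (o ℕ.+ o)
      n<3+2o = s≤s (ℕₚ.≤-trans n≤o (ℕₚ.≤-trans (ℕₚ.m≤m+n o o) (ℕₚ.m≤n+m (o ℕ.+ o) 2)))

    module Step (M : ℕ) where
      o x o′ : ℕ
      o  = suc (double M)
      x  = suc o
      o′ = suc x

      x+x : ∀ o → suc o ℕ.+ suc o ≡ 2 ℕ.+ (o ℕ.+ o)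
      x+x = ℕ-Solver.solve-∀
      x+o′ : ∀ o → suc o ℕ.+ suc (suc o) ≡ 3 ℕ.+ (o ℕ.+ o)
      x+o′ = ℕ-Solver.solve-∀
      o′+o′ : ∀ o → suc (suc o) ℕ.+ suc (suc o) ≡ 4 ℕ.+ (o ℕ.+ o)
      o′+o′ = ℕ-Solver.solve-∀
      x+3+o : ∀ o → suc o ℕ.+ (3 ℕ.+ o) ≡ 4 ℕ.+ (o ℕ.+ o)
      x+3+o = ℕ-Solver.solve-∀
      3+2o+x : ∀ o → 3 ℕ.+ (o ℕ.+ o) ℕ.+ suc o ≡ 4 ℕ.+ (o ℕ.+ o ℕ.+ o)
      3+2o+x = ℕ-Solver.solve-∀
      3+2o+o′ : ∀ o → 3 ℕ.+ (o ℕ.+ o) ℕ.+ suc (suc o) ≡ 5 ℕ.+ (o ℕ.+ o ℕ.+ o)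
      3+2o+o′ = ℕ-Solver.solve-∀
      x+3+2o : ∀ o → suc o ℕ.+ (3 ℕ.+ (o ℕ.+ o)) ≡ 4 ℕ.+ (o ℕ.+ o ℕ.+ o)
      x+3+2o = ℕ-Solver.solve-∀
      x+4+2o : ∀ o → suc o ℕ.+ (4 ℕ.+ (o ℕ.+ o)) ≡ 5 ℕ.+ (o ℕ.+ o ℕ.+ o)
      x+4+2o = ℕ-Solver.solve-∀

      shift² : ∀ e f {g} s m → e ℕ.+ f ≡ g → shift e (shift f s) m ≡ shift g s m
      shift² e f s m refl = shift-+ e f s m

      D≈ : D o′ ≈ D o ⊕ shift (4 ℕ.+ (o ℕ.+ o)) (A o′)
      D≈ = begin
        D o′                                 ≈⟨ D-odd x (odd-suc-double (suc M)) ⟩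
        D x ⊕ shift (o′ ℕ.+ o′) (A o′)       ≈⟨ ⊕-cong (D-even o (even-double (suc M)))
                                                       (λ n → cong (λ e → shift e (A o′) n) (o′+o′ o)) ⟩
        D o ⊕ shift (4 ℕ.+ (o ℕ.+ o)) (A o′) ∎
        where open ≈-Reasoning

      a b : ℕ → ℕ → ℤ
      a e m = shift e (A o) m
      b e m = shift e (A o′) m

      expand : ∀ e {e₁ e₂} m → e ℕ.+ x ≡ e₁ → e ℕ.+ o′ ≡ e₂ → b e m ≡ a e m + a e₁ m + b e₂ m
      expand e m refl refl = begin
        shift e (A o′) m
          ≡⟨ shift-cong e (A-odd-double (suc M)) m ⟩
        shift e (A x ⊕ shift o′ (A o′)) m
          ≡⟨ shift-⊕ e (A x) (shift o′ (A o′)) m ⟩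
        shift e (A x) m + shift e (shift o′ (A o′)) m
          ≡⟨ cong₂ _+_ (shift-cong e (A-even-double M) m) (shift-+ e o′ (A o′) m) ⟩
        shift e (A o ⊕ shift x (A o)) m + b (e ℕ.+ o′) m
          ≡⟨ cong (_+ b (e ℕ.+ o′) m) (shift-⊕ e (A o) (shift x (A o)) m) ⟩
        a e m + shift e (shift x (A o)) m + b (e ℕ.+ o′) m
          ≡⟨ cong (λ c → a e m + c + b (e ℕ.+ o′) m) (shift-+ e x (A o) m) ⟩
        a e m + a (e ℕ.+ x) m + b (e ℕ.+ o′) m ∎
        where open ≡-Reasoning

      -- L is tele o′ (A o′) minus (1 + q³) q^(2o+4) · A o′, the new part of (1 + q³) · D o′
      L : Series
      L = A o′ ⊖ shift 1 (A o′) ⊕ shift (3 ℕ.+ o) (A o′) ⊖ shift (4 ℕ.+ (o ℕ.+ o)) (A o′)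

      shift-L : ∀ m → shift x L m
                    ≡ b (1 ℕ.+ o) m - b (2 ℕ.+ o) m + b (4 ℕ.+ (o ℕ.+ o)) m - b (5 ℕ.+ (o ℕ.+ o ℕ.+ o)) m
      shift-L m = begin
        shift x L m
          ≡⟨ shift-⊖ x (A o′ ⊖ shift 1 (A o′) ⊕ shift (3 ℕ.+ o) (A o′)) (shift (4 ℕ.+ (o ℕ.+ o)) (A o′)) m ⟩
        shift x (A o′ ⊖ shift 1 (A o′) ⊕ shift (3 ℕ.+ o) (A o′)) m - shift x (shift (4 ℕ.+ (o ℕ.+ o)) (A o′)) m
          ≡⟨ cong₂ _-_ (shift-⊕ x (A o′ ⊖ shift 1 (A o′)) (shift (3 ℕ.+ o) (A o′)) m)
                       (shift² x (4 ℕ.+ (o ℕ.+ o)) (A o′) m (x+4+2o o)) ⟩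
        shift x (A o′ ⊖ shift 1 (A o′)) m + shift x (shift (3 ℕ.+ o) (A o′)) m - b (5 ℕ.+ (o ℕ.+ o ℕ.+ o)) m
          ≡⟨ cong₂ (λ c d → c + d - b (5 ℕ.+ (o ℕ.+ o ℕ.+ o)) m)
                   (trans (shift-⊖ x (A o′) (shift 1 (A o′)) m)
                          (cong (b x m -_) (shift² x 1 (A o′) m (ℕₚ.+-comm x 1))))
                   (shift² x (3 ℕ.+ o) (A o′) m (x+3+o o)) ⟩
        b (1 ℕ.+ o) m - b (2 ℕ.+ o) m + b (4 ℕ.+ (o ℕ.+ o)) m - b (5 ℕ.+ (o ℕ.+ o ℕ.+ o)) m ∎
        where open ≡-Reasoning

      shift-tele : ∀ m → shift x (tele o (A o)) m
                       ≡ a (1 ℕ.+ o) m - a (2 ℕ.+ o) m + a (2 ℕ.+ (o ℕ.+ o)) m + a (4 ℕ.+ (o ℕ.+ o ℕ.+ o)) m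
      shift-tele m = begin
        shift x (tele o (A o)) m
          ≡⟨ shift-⊕ x (A o ⊖ shift 1 (A o) ⊕ shift x (A o)) (shift (3 ℕ.+ (o ℕ.+ o)) (A o)) m ⟩
        shift x (A o ⊖ shift 1 (A o) ⊕ shift x (A o)) m + shift x (shift (3 ℕ.+ (o ℕ.+ o)) (A o)) m
          ≡⟨ cong₂ _+_ (shift-⊕ x (A o ⊖ shift 1 (A o)) (shift x (A o)) m)
                       (shift² x (3 ℕ.+ (o ℕ.+ o)) (A o) m (x+3+2o o)) ⟩
        shift x (A o ⊖ shift 1 (A o)) m + shift x (shift x (A o)) m + a (4 ℕ.+ (o ℕ.+ o ℕ.+ o)) m
          ≡⟨ cong₂ (λ c d → c + d + a (4 ℕ.+ (o ℕ.+ o ℕ.+ o)) m)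
                   (trans (shift-⊖ x (A o) (shift 1 (A o)) m)
                          (cong (a x m -_) (shift² x 1 (A o) m (ℕₚ.+-comm x 1))))
                   (shift² x x (A o) m (x+x o)) ⟩
        a (1 ℕ.+ o) m - a (2 ℕ.+ o) m + a (2 ℕ.+ (o ℕ.+ o)) m + a (4 ℕ.+ (o ℕ.+ o ℕ.+ o)) m ∎
        where open ≡-Reasoning

      -- variable names record exponents: ao1 stands for a (o+1), b2o3 for b (2o+3), and so on
      linear-identity : ∀ a₀ a₁ ao1 ao2 a2o2 a2o3 a3o4 b₀ b₁ bo1 bo2 bo3 b2o3 b2o4 b3o5 →
        b₀ ≡ a₀ + ao1 + bo2 → b₁ ≡ a₁ + ao2 + bo3 → bo1 ≡ ao1 + a2o2 + b2o3 → b2o3 ≡ a2o3 + a3o4 + b3o5 →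
        (b₀ - b₁ + bo3 - b2o4) + (bo1 - bo2 + b2o4 - b3o5) ≡ (a₀ - a₁ + ao1 + a2o3) + (ao1 - ao2 + a2o2 + a3o4)
      linear-identity a₀ a₁ ao1 ao2 a2o2 a2o3 a3o4 _ _ _ bo2 bo3 _ b2o4 b3o5 refl refl refl refl =
        solve a₀ a₁ ao1 ao2 a2o2 a2o3 a3o4 bo2 bo3 b2o4 b3o5
        where
        solve : ∀ a₀ a₁ ao1 ao2 a2o2 a2o3 a3o4 bo2 bo3 b2o4 b3o5 →
          (a₀ + ao1 + bo2 - (a₁ + ao2 + bo3) + bo3 - b2o4)
            + (ao1 + a2o2 + (a2o3 + a3o4 + b3o5) - bo2 + b2o4 - b3o5)
            ≡ (a₀ - a₁ + ao1 + a2o3) + (ao1 - ao2 + a2o2 + a3o4)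
        solve = solve-∀

      onePlusQ-L≡onePlusQ-tele : ∀ m → L m + shift x L m ≡ tele o (A o) m + shift x (tele o (A o)) m
      onePlusQ-L≡onePlusQ-tele m = begin
        L m + shift x L m
          ≡⟨ cong (λ c → L m + c) (shift-L m) ⟩
        (b 0 m - b 1 m + b (3 ℕ.+ o) m - b (4 ℕ.+ (o ℕ.+ o)) m)
          + (b (1 ℕ.+ o) m - b (2 ℕ.+ o) m + b (4 ℕ.+ (o ℕ.+ o)) m - b (5 ℕ.+ (o ℕ.+ o ℕ.+ o)) m)
          ≡⟨ linear-identity
               (a 0 m) (a 1 m) (a (1 ℕ.+ o) m) (a (2 ℕ.+ o) m) (a (2 ℕ.+ (o ℕ.+ o)) m) (a (3 ℕ.+ (o ℕ.+ o)) m)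
               (a (4 ℕ.+ (o ℕ.+ o ℕ.+ o)) m)
               _ _ _ (b (2 ℕ.+ o) m) (b (3 ℕ.+ o) m) _ (b (4 ℕ.+ (o ℕ.+ o)) m) (b (5 ℕ.+ (o ℕ.+ o ℕ.+ o)) m)
               (expand 0 m refl refl) (expand 1 m refl refl)
               (expand (1 ℕ.+ o) m (x+x o) (x+o′ o)) (expand (3 ℕ.+ (o ℕ.+ o)) m (3+2o+x o) (3+2o+o′ o)) ⟩
        tele o (A o) m + (a (1 ℕ.+ o) m - a (2 ℕ.+ o) m + a (2 ℕ.+ (o ℕ.+ o)) m + a (4 ℕ.+ (o ℕ.+ o ℕ.+ o)) m)
          ≡⟨ cong (λ c → tele o (A o) m + c) (shift-tele m) ⟨
        tele o (A o) m + shift x (tele o (A o)) m ∎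
        where open ≡-Reasoning

      L≈tele : L ≈ tele o (A o)
      L≈tele n =
        ⊕-shift-cancel o n {L} {tele o (A o)} (λ m _ → onePlusQ-L≡onePlusQ-tele m) n ℕₚ.≤-refl

      tele-step : tele o (A o) ≈ δ ⊕ D o ⊕ shift 3 (D o) → tele o′ (A o′) ≈ δ ⊕ D o′ ⊕ shift 3 (D o′)
      tele-step IH n = begin
        tele o′ (A o′) n
          ≡⟨ cong (λ e → A o′ n - b 1 n + b (3 ℕ.+ o) n + b e n) (cong (3 ℕ.+_) (o′+o′ o)) ⟩
        A o′ n - b 1 n + b (3 ℕ.+ o) n + b (7 ℕ.+ (o ℕ.+ o)) n
          ≡⟨ regroup (A o′ n) (b 1 n) (b (3 ℕ.+ o) n) (b (4 ℕ.+ (o ℕ.+ o)) n) (b (7 ℕ.+ (o ℕ.+ o)) n) ⟩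
        L n + b (4 ℕ.+ (o ℕ.+ o)) n + b (7 ℕ.+ (o ℕ.+ o)) n
          ≡⟨ cong (λ c → c + b (4 ℕ.+ (o ℕ.+ o)) n + b (7 ℕ.+ (o ℕ.+ o)) n) (trans (L≈tele n) (IH n)) ⟩
        δ n + D o n + shift 3 (D o) n + b (4 ℕ.+ (o ℕ.+ o)) n + b (7 ℕ.+ (o ℕ.+ o)) n
          ≡⟨ regroup′ (δ n) (D o n) (shift 3 (D o) n) (b (4 ℕ.+ (o ℕ.+ o)) n) (b (7 ℕ.+ (o ℕ.+ o)) n) ⟩
        δ n + (D o n + b (4 ℕ.+ (o ℕ.+ o)) n) + (shift 3 (D o) n + b (7 ℕ.+ (o ℕ.+ o)) n)
          ≡⟨ cong₂ (λ d d′ → δ n + d + d′) (D≈ n) shift₃D≈ ⟨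
        δ n + D o′ n + shift 3 (D o′) n ∎
        where
        open ≡-Reasoning
        shift₃D≈ : shift 3 (D o′) n ≡ shift 3 (D o) n + b (7 ℕ.+ (o ℕ.+ o)) n
        shift₃D≈ = trans (shift-cong 3 D≈ n)
          (trans (shift-⊕ 3 (D o) (shift (4 ℕ.+ (o ℕ.+ o)) (A o′)) n)
                 (cong (λ c → shift 3 (D o) n + c) (shift-+ 3 (4 ℕ.+ (o ℕ.+ o)) (A o′) n)))
        regroup : ∀ p q r s t → p - q + r + t ≡ p - q + r - s + s + t
        regroup = solve-∀
        regroup′ : ∀ d e f s t → d + e + f + s + t ≡ d + (e + s) + (f + t)
        regroup′ = solve-∀

    telescoping : ∀ M → let o = suc (double M) in tele o (A o) ≈ δ ⊕ D o ⊕ shift 3 (D o)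
    telescoping zero    n = begin
      A 1 n - shift 1 (A 1) n + shift 2 (A 1) n + shift 5 (A 1) n
        ≡⟨ cong (λ a → a - shift 1 (A 1) n + shift 2 (A 1) n + shift 5 (A 1) n) A₁≈ ⟩
      δ n + shift 1 (A 1) n - shift 1 (A 1) n + shift 2 (A 1) n + shift 5 (A 1) n
        ≡⟨ cancel (δ n) (shift 1 (A 1) n) _ _ ⟩
      δ n + shift 2 (A 1) n + shift 5 (A 1) n
        ≡⟨ cong (λ c → δ n + shift 2 (A 1) n + c) (shift-+ 3 2 (A 1) n) ⟨
      δ n + shift 2 (A 1) n + shift 3 (shift 2 (A 1)) n
        ≡⟨ cong₂ (λ d d′ → δ n + d + d′) (D₁≈ n) (shift-cong 3 D₁≈ n) ⟨
      δ n + D 1 n + shift 3 (D 1) n ∎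
      where
      open ≡-Reasoning
      A₁≈ : A 1 n ≡ δ n + shift 1 (A 1) n
      A₁≈ = trans (A-odd-double 0 n) (cong (_+ shift 1 (A 1) n) (A-zero n))
      D₁≈ : D 1 ≈ shift 2 (A 1)
      D₁≈ m = trans (D-odd 0 (odd-suc-double 0) m)
                    (trans (cong (_+ shift 2 (A 1) m) (D-zero m)) (ℤₚ.+-identityˡ _))
      cancel : ∀ d a b c → d + a - a + b + c ≡ d + b + c
      cancel = solve-∀
    telescoping (suc M) = Step.tele-step M (telescoping M)

module BoundedPartitions where
  open import Defs using (partsFuel; partitions)
  open import Data.Nat using (zero; _≤_; _<_; s≤s; _∸_; _⊓_; _<?_)
  import Data.Nat.Properties as ℕₚ
  open import Data.List using (List; []; _∷_; [_]; _++_; filter; map; concatMap; upTo)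
  open import Data.List.Properties
    using (filter-++; filter-accept; filter-reject; concatMap-cong; concatMap-++; upTo-∷ʳ; ++-identityʳ)
  open import Data.List.Relation.Unary.All as All using (All; []; _∷_)
  import Data.List.Relation.Unary.All.Properties as Allₚ
  open import Relation.Nullary using (Dec; yes; no)
  open import Relation.Binary.PropositionalEquality hiding ([_])

  partitions≤ : ℕ → ℕ → List (List ℕ)
  partitions≤ m n = partsFuel n m n

  partsFuel-fuel : ∀ f f′ m n → n ≤ f → n ≤ f′ → partsFuel f m n ≡ partsFuel f′ m n
  partsFuel-fuel f        f′        m zero    _         _          = refl
  partsFuel-fuel (suc f)  (suc f′)  m (suc n) (s≤s n≤f) (s≤s n≤f′) =
    concatMap-cong (λ k → cong (map (suc k ∷_))
      (partsFuel-fuel f f′ (suc k) (n ∸ k) (ℕₚ.≤-trans (ℕₚ.m∸n≤m n k) n≤f) (ℕₚ.≤-trans (ℕₚ.m∸n≤m n k) n≤f′)))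
      (filter (_<? m) (upTo (suc n)))

  filter-<-upTo : ∀ m N → filter (_<? m) (upTo N) ≡ upTo (m ⊓ N)
  filter-<-upTo m zero    = cong upTo (sym (ℕₚ.⊓-zeroʳ m))
  filter-<-upTo m (suc N) = begin
    filter (_<? m) (upTo (suc N))                       ≡⟨ cong (filter (_<? m)) (upTo-∷ʳ N) ⟨
    filter (_<? m) (upTo N ++ [ N ])                    ≡⟨ filter-++ (_<? m) (upTo N) [ N ] ⟩
    filter (_<? m) (upTo N) ++ filter (_<? m) [ N ]     ≡⟨ cong (_++ filter (_<? m) [ N ]) (filter-<-upTo m N) ⟩
    upTo (m ⊓ N) ++ filter (_<? m) [ N ]                ≡⟨ last-step (N <? m) ⟩
    upTo (m ⊓ suc N)                                    ∎
    where
    open ≡-Reasoning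
    last-step : Dec (N < m) → upTo (m ⊓ N) ++ filter (_<? m) [ N ] ≡ upTo (m ⊓ suc N)
    last-step (yes N<m) = begin
      upTo (m ⊓ N) ++ filter (_<? m) [ N ]
        ≡⟨ cong₂ (λ k ys → upTo k ++ ys) (ℕₚ.m≥n⇒m⊓n≡n (ℕₚ.<⇒≤ N<m)) (filter-accept (_<? m) N<m) ⟩
      upTo N ++ [ N ]                      ≡⟨ upTo-∷ʳ N ⟩
      upTo (suc N)                         ≡⟨ cong upTo (ℕₚ.m≥n⇒m⊓n≡n N<m) ⟨
      upTo (m ⊓ suc N)                     ∎
    last-step (no N≮m) = begin
      upTo (m ⊓ N) ++ filter (_<? m) [ N ]
        ≡⟨ cong₂ (λ k ys → upTo k ++ ys) (ℕₚ.m≤n⇒m⊓n≡m m≤N) (filter-reject (_<? m) N≮m) ⟩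
      upTo m ++ []                         ≡⟨ ++-identityʳ (upTo m) ⟩
      upTo m                               ≡⟨ cong upTo (ℕₚ.m≤n⇒m⊓n≡m (ℕₚ.m≤n⇒m≤1+n m≤N)) ⟨
      upTo (m ⊓ suc N)                     ∎
      where m≤N = ℕₚ.≮⇒≥ N≮m

  -- the partitions of suc n with largest part suc k
  withLargest : ℕ → ℕ → List (List ℕ)
  withLargest n k = map (suc k ∷_) (partitions≤ (suc k) (n ∸ k))

  -- the partitions of suc n with largest part ≤ b
  largestUpTo : ℕ → ℕ → List (List ℕ)
  largestUpTo n b = concatMap (withLargest n) (upTo b)

  largestUpTo-suc : ∀ n b → largestUpTo n (suc b) ≡ largestUpTo n b ++ withLargest n b
  largestUpTo-suc n b = begin
    concatMap (withLargest n) (upTo (suc b))                   ≡⟨ cong (concatMap (withLargest n)) (upTo-∷ʳ b) ⟨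
    concatMap (withLargest n) (upTo b ++ [ b ])                ≡⟨ concatMap-++ (withLargest n) (upTo b) [ b ] ⟩
    concatMap (withLargest n) (upTo b) ++ withLargest n b ++ [] ≡⟨ cong (largestUpTo n b ++_) (++-identityʳ _) ⟩
    largestUpTo n b ++ withLargest n b                         ∎
    where open ≡-Reasoning

  partitions≤-suc : ∀ m n → partitions≤ m (suc n) ≡ largestUpTo n (m ⊓ suc n)
  partitions≤-suc m n = begin
    concatMap (λ k → map (suc k ∷_) (partsFuel n (suc k) (n ∸ k))) (filter (_<? m) (upTo (suc n)))
      ≡⟨ concatMap-cong
           (λ k → cong (map (suc k ∷_)) (partsFuel-fuel n (n ∸ k) (suc k) (n ∸ k) (ℕₚ.m∸n≤m n k) ℕₚ.≤-refl))
           (filter (_<? m) (upTo (suc n))) ⟩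
    concatMap (withLargest n) (filter (_<? m) (upTo (suc n)))
      ≡⟨ cong (concatMap (withLargest n)) (filter-<-upTo m (suc n)) ⟩
    largestUpTo n (m ⊓ suc n) ∎
    where open ≡-Reasoning

  partitions≤-large : ∀ {m n} → n ≤ m → partitions≤ m n ≡ partitions n
  partitions≤-large {m} {zero}  _   = refl
  partitions≤-large {m} {suc n} n<m = begin
    partitions≤ m (suc n)          ≡⟨ partitions≤-suc m n ⟩
    largestUpTo n (m ⊓ suc n)      ≡⟨ cong (largestUpTo n) (trans (ℕₚ.m≥n⇒m⊓n≡n n<m) (sym (ℕₚ.⊓-idem (suc n)))) ⟩
    largestUpTo n (suc n ⊓ suc n)  ≡⟨ partitions≤-suc (suc n) n ⟨
    partitions (suc n)             ∎
    where open ≡-Reasoning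

  partitions≤-step : ∀ {m n} → m ≤ n → partitions≤ (suc m) (suc n) ≡ partitions≤ m (suc n) ++ withLargest n m
  partitions≤-step {m} {n} m≤n = begin
    partitions≤ (suc m) (suc n)                  ≡⟨ partitions≤-suc (suc m) n ⟩
    largestUpTo n (suc m ⊓ suc n)                ≡⟨ cong (largestUpTo n) (ℕₚ.m≤n⇒m⊓n≡m (s≤s m≤n)) ⟩
    largestUpTo n (suc m)                        ≡⟨ largestUpTo-suc n m ⟩
    largestUpTo n m ++ withLargest n m           ≡⟨ cong (λ b → largestUpTo n b ++ withLargest n m) m⊓1+n≡m ⟨
    largestUpTo n (m ⊓ suc n) ++ withLargest n m ≡⟨ cong (_++ withLargest n m) (partitions≤-suc m n) ⟨
    partitions≤ m (suc n) ++ withLargest n m     ∎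
    where
    open ≡-Reasoning
    m⊓1+n≡m = ℕₚ.m≤n⇒m⊓n≡m (ℕₚ.m≤n⇒m≤1+n m≤n)

  partitions≤-zero : ∀ n → partitions≤ 0 (suc n) ≡ []
  partitions≤-zero n = partitions≤-suc 0 n

  partsFuel-bounded : ∀ f m n → All (All (_≤ m)) (partsFuel f m n)
  partsFuel-bounded f       m zero    = [] ∷ []
  partsFuel-bounded zero    m (suc n) = []
  partsFuel-bounded (suc f) m (suc n) = Allₚ.concat⁺ (Allₚ.map⁺ (All.map
    (λ {k} k<m → Allₚ.map⁺ (All.map (λ ps≤k → k<m ∷ All.map (λ p≤k → ℕₚ.≤-trans p≤k k<m) ps≤k)
                                     (partsFuel-bounded f (suc k) (n ∸ k))))
    (Allₚ.all-filter (_<? m) (upTo (suc n)))))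

  partitions≤-bounded : ∀ m n → All (All (_≤ m)) (partitions≤ m n)
  partitions≤-bounded m n = partsFuel-bounded n m n

module PartitionSeries where
  open import Data.Nat as ℕ using (zero; _≤_; _∸_)
  import Data.Nat.Properties as ℕₚ
  open import Data.Integer using (+_; _+_)
  import Data.Integer.Properties as ℤₚ
  open import Data.List using (List; []; _∷_; _++_; length; filter; map)
  open import Data.List.Properties using (length-++; filter-++; filter-none)
  open import Data.List.Relation.Unary.All as All using (All; []; _∷_)
  open import Data.Empty using (⊥-elim)
  open import Function.Base using (_∘_)
  open import Function.Bundles using (_⇔_; Equivalence)
  open import Relation.Nullary using (yes; no)
  open import Relation.Unary using (Decidable)
  open import Relation.Binary.PropositionalEquality
  open PowerSeries
  open BoundedPartitions

  countBy : {A : Set} {P : A → Set} → Decidable P → List A → ℕ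
  countBy P? xs = length (filter P? xs)

  module _ {A : Set} {P : A → Set} (P? : Decidable P) where
    countBy-++ : ∀ xs ys → countBy P? (xs ++ ys) ≡ countBy P? xs ℕ.+ countBy P? ys
    countBy-++ xs ys = trans (cong length (filter-++ P? xs ys)) (length-++ (filter P? xs))

    countBy-none : ∀ {xs} → All (¬_ ∘ P) xs → countBy P? xs ≡ 0
    countBy-none none = cong length (filter-none P? none)

    countBy-map : ∀ {B : Set} (f : B → A) xs → countBy P? (map f xs) ≡ countBy (P? ∘ f) xs
    countBy-map f []       = refl
    countBy-map f (x ∷ xs) with P? (f x)
    ... | yes _ = cong suc (countBy-map f xs)
    ... | no  _ = countBy-map f xs

    countBy-≐ : ∀ {Q : A → Set} (Q? : Decidable Q) {xs} →
                All (λ x → P x ⇔ Q x) xs → countBy P? xs ≡ countBy Q? xs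
    countBy-≐ Q? [] = refl
    countBy-≐ Q? {x ∷ xs} (P⇔Q ∷ rest) with P? x | Q? x
    ... | yes _ | yes _  = cong suc (countBy-≐ Q? rest)
    ... | no  _ | no  _  = countBy-≐ Q? rest
    ... | yes p | no ¬q  = ⊥-elim (¬q (Equivalence.to P⇔Q p))
    ... | no ¬p | yes q  = ⊥-elim (¬p (Equivalence.from P⇔Q q))

  partitionSeries : {P : List ℕ → Set} → Decidable P → ℕ → Series
  partitionSeries P? m n = + countBy P? (partitions≤ m n)

  partitionSeries-step : ∀ {P} (P? : Decidable P) m →
    partitionSeries P? (suc m) ≈ partitionSeries P? m ⊕ shift (suc m) (partitionSeries (P? ∘ (suc m ∷_)) (suc m))
  partitionSeries-step P? m zero    = sym (ℤₚ.+-identityʳ _)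
  partitionSeries-step P? m (suc n) with m ℕₚ.≤? n
  ... | yes m≤n = begin
    + countBy P? (partitions≤ (suc m) (suc n))
      ≡⟨ cong (λ xs → + countBy P? xs) (partitions≤-step m≤n) ⟩
    + countBy P? (partitions≤ m (suc n) ++ withLargest n m)
      ≡⟨ cong +_ (countBy-++ P? (partitions≤ m (suc n)) (withLargest n m)) ⟩
    + (countBy P? (partitions≤ m (suc n)) ℕ.+ countBy P? (withLargest n m))
      ≡⟨ cong (λ c → + (countBy P? (partitions≤ m (suc n)) ℕ.+ c))
              (countBy-map P? (suc m ∷_) (partitions≤ (suc m) (n ∸ m))) ⟩
    partitionSeries P? m (suc n) + partitionSeries (P? ∘ (suc m ∷_)) (suc m) (n ∸ m)
      ≡⟨ cong (λ c → partitionSeries P? m (suc n) + c) (shift-above m _ m≤n) ⟨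
    partitionSeries P? m (suc n) + shift (suc m) (partitionSeries (P? ∘ (suc m ∷_)) (suc m)) (suc n) ∎
    where open ≡-Reasoning
  ... | no m≰n = begin
    partitionSeries P? (suc m) (suc n)
      ≡⟨ cong (λ xs → + countBy P? xs)
              (trans (partitions≤-large (ℕₚ.m≤n⇒m≤1+n n<m)) (sym (partitions≤-large n<m))) ⟩
    partitionSeries P? m (suc n)
      ≡⟨ ℤₚ.+-identityʳ _ ⟨
    partitionSeries P? m (suc n) + + 0
      ≡⟨ cong (λ c → partitionSeries P? m (suc n) + c) (shift-below m _ (ℕₚ.≰⇒> m≰n)) ⟨
    partitionSeries P? m (suc n) + shift (suc m) (partitionSeries (P? ∘ (suc m ∷_)) (suc m)) (suc n) ∎
    where
    open ≡-Reasoning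
    n<m = ℕₚ.≰⇒> m≰n

  partitionSeries-zero : ∀ {P} (P? : Decidable P) n → partitionSeries P? 0 (suc n) ≡ + 0
  partitionSeries-zero P? n = cong (λ xs → + countBy P? xs) (partitions≤-zero n)

  partitionSeries-≐ : ∀ {P Q} (P? : Decidable P) (Q? : Decidable Q) m →
    (∀ ps → All (_≤ m) ps → P ps ⇔ Q ps) → partitionSeries P? m ≈ partitionSeries Q? m
  partitionSeries-≐ P? Q? m P⇔Q n =
    cong +_ (countBy-≐ P? Q? (All.map (λ {ps} → P⇔Q ps) (partitions≤-bounded m n)))

  partitionSeries-none : ∀ {P} (P? : Decidable P) m →
    (∀ ps → All (_≤ m) ps → ¬ P ps) → partitionSeries P? m ≈ 0ₛ
  partitionSeries-none P? m none n =
    cong +_ (countBy-none P? (All.map (λ {ps} → none ps) (partitions≤-bounded m n)))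

  partitionSeries-headFree : ∀ {P} (P? : Decidable P) m → (∀ ps → P (suc m ∷ ps) ⇔ P ps) →
    partitionSeries P? (suc m) ≈ partitionSeries P? m ⊕ shift (suc m) (partitionSeries P? (suc m))
  partitionSeries-headFree P? m head⇔ = ≈-trans (partitionSeries-step P? m)
    (⊕-cong (≈-refl {partitionSeries P? m})
            (shift-cong (suc m) (partitionSeries-≐ (P? ∘ (suc m ∷_)) P? (suc m) (λ ps _ → head⇔ ps))))

  partitionSeries-headExcluded : ∀ {P} (P? : Decidable P) m → (∀ ps → ¬ P (suc m ∷ ps)) →
    partitionSeries P? (suc m) ≈ partitionSeries P? m
  partitionSeries-headExcluded P? m excluded n = begin
    partitionSeries P? (suc m) n
      ≡⟨ partitionSeries-step P? m n ⟩
    partitionSeries P? m n + shift (suc m) (partitionSeries (P? ∘ (suc m ∷_)) (suc m)) n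
      ≡⟨ cong (λ c → partitionSeries P? m n + c) (trans (shift-cong (suc m) none n) (shift-0ₛ (suc m) n)) ⟩
    partitionSeries P? m n + + 0
      ≡⟨ ℤₚ.+-identityʳ _ ⟩
    partitionSeries P? m n ∎
    where
    open ≡-Reasoning
    none = partitionSeries-none (P? ∘ (suc m ∷_)) (suc m) (λ ps _ → excluded ps)

module Multiplicities where
  open import Defs using (count; IsDE2)
  open import Data.Nat using (_≤_; z≤n; s≤s; _≟_; _≤?_)
  import Data.Nat.Properties as ℕₚ
  open import Data.Nat.Divisibility using (_∣?_)
  open import Data.List using (List; _∷_)
  open import Data.List.Relation.Unary.All as All using (All; []; _∷_; all?)
  open import Data.Product using (_×_; _,_; proj₁; proj₂)
  open import Data.Empty using (⊥-elim)
  open import Function.Base using (_∘_)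
  open import Function.Bundles using (_⇔_; mk⇔)
  open import Relation.Nullary using (Dec; yes; no)
  open import Relation.Nullary.Decidable using (_→-dec_)
  open import Relation.Unary using (Decidable)
  open import Relation.Binary.PropositionalEquality

  count-here : ∀ x ps → count x (x ∷ ps) ≡ suc (count x ps)
  count-here x ps with x ≟ x
  ... | yes _   = refl
  ... | no  x≢x = ⊥-elim (x≢x refl)

  count-there : ∀ {k x} ps → k ≢ x → count k (x ∷ ps) ≡ count k ps
  count-there {k} {x} ps k≢x with k ≟ x
  ... | yes k≡x = ⊥-elim (k≢x k≡x)
  ... | no  _   = refl

  count-≤-∷ : ∀ k x ps → count k ps ≤ count k (x ∷ ps)
  count-≤-∷ k x ps with k ≟ x
  ... | yes _ = ℕₚ.n≤1+n _
  ... | no  _ = ℕₚ.≤-refl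

  count-absent : ∀ {m ps} → All (_≤ m) ps → count (suc m) ps ≡ 0
  count-absent {m} []                 = refl
  count-absent {m} {p ∷ ps} (p≤m ∷ ps≤m) =
    trans (count-there {x = p} ps (λ { refl → ℕₚ.n≮n m p≤m })) (count-absent ps≤m)

  DistinctEven : List ℕ → Set
  DistinctEven ps = All (λ k → Even k → count k ps ≤ 1) ps

  distinctEven? : Decidable DistinctEven
  distinctEven? ps = all? (λ k → (2 ∣? k) →-dec (count k ps ≤? 1)) ps

  distinctEven-∷⁻ : ∀ {x ps} → DistinctEven (x ∷ ps) → (Even x → count x ps ≡ 0) × DistinctEven ps
  distinctEven-∷⁻ {x} {ps} (x-ok ∷ ps-ok) =
      (λ e → ℕₚ.n≤0⇒n≡0 (ℕₚ.≤-pred (subst (_≤ 1) (count-here x ps) (x-ok e))))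
    , All.map (λ {k} k-ok e → ℕₚ.≤-trans (count-≤-∷ k x ps) (k-ok e)) ps-ok

  distinctEven-∷⁺ : ∀ {x ps} → (Even x → count x ps ≡ 0) → DistinctEven ps → DistinctEven (x ∷ ps)
  distinctEven-∷⁺ {x} {ps} fresh ps-ok = x-ok ∷ All.map (λ {k} → k-ok k) ps-ok
    where
    x-ok : Even x → count x (x ∷ ps) ≤ 1
    x-ok e = subst (_≤ 1) (sym (trans (count-here x ps) (cong suc (fresh e)))) ℕₚ.≤-refl
    k-ok : ∀ k → (Even k → count k ps ≤ 1) → Even k → count k (x ∷ ps) ≤ 1
    k-ok k old e = by-cases (k ≟ x)
      where
      by-cases : Dec (k ≡ x) → count k (x ∷ ps) ≤ 1
      by-cases (yes refl) = x-ok e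
      by-cases (no k≢x)   = subst (_≤ 1) (sym (count-there ps k≢x)) (old e)

  distinctEven-∷-odd : ∀ {x ps} → ¬ Even x → DistinctEven (x ∷ ps) ⇔ DistinctEven ps
  distinctEven-∷-odd odd = mk⇔ (proj₂ ∘ distinctEven-∷⁻) (distinctEven-∷⁺ (⊥-elim ∘ odd))

  distinctEven-∷-even : ∀ {x ps} → Even x → DistinctEven (x ∷ ps) ⇔ (count x ps ≡ 0 × DistinctEven ps)
  distinctEven-∷-even even = mk⇔
    (λ ok → proj₁ (distinctEven-∷⁻ ok) even , proj₂ (distinctEven-∷⁻ ok))
    (λ (fresh , ok) → distinctEven-∷⁺ (λ _ → fresh) ok)

  isDE2-∷-odd : ∀ {x ps} → ¬ Even x → IsDE2 (x ∷ ps) ⇔ (1 ≤ count x ps × DistinctEven ps)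
  isDE2-∷-odd {x} {ps} odd = mk⇔
    (λ (ok , _ , twice) → ℕₚ.≤-pred (subst (2 ≤_) (count-here x ps) twice) , proj₂ (distinctEven-∷⁻ ok))
    (λ (once , ok) → distinctEven-∷⁺ (⊥-elim ∘ odd) ok , odd , subst (2 ≤_) (sym (count-here x ps)) (s≤s once))

  occurs-∷-odd : ∀ {x ps} → ¬ Even x → (1 ≤ count x (x ∷ ps) × DistinctEven (x ∷ ps)) ⇔ DistinctEven ps
  occurs-∷-odd {x} {ps} odd = mk⇔
    (λ (_ , ok) → proj₂ (distinctEven-∷⁻ ok))
    (λ ok → subst (1 ≤_) (sym (count-here x ps)) (s≤s z≤n) , distinctEven-∷⁺ (⊥-elim ∘ odd) ok)

module Recurrences where
  open import Defs
  open import Data.Nat as ℕ using (zero; _≤_; _≟_; _≤?_)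
  import Data.Nat.Properties as ℕₚ
  open import Data.Integer using (+_)
  import Data.Integer.Properties as ℤₚ
  open import Data.List using (_∷_)
  open import Data.List.Relation.Unary.All as All using (_∷_)
  open import Data.Product using (_×_; _,_; proj₂)
  open import Function.Base using (_∘_)
  open import Function.Bundles using (mk⇔)
  open import Relation.Nullary using (yes; no)
  open import Relation.Nullary.Decidable using (_×-dec_)
  open import Relation.Unary using (Decidable)
  open import Relation.Binary.PropositionalEquality
  open PowerSeries
  open Arithmetic using (GoodPart)
  open BoundedPartitions using (partitions≤-large)
  open PartitionSeries
  open Multiplicities

  A G D : ℕ → Series
  A = partitionSeries distinctEven?
  G = partitionSeries goodParts?
  D = partitionSeries isDE2?

  A-zero : A 0 ≈ δ
  A-zero zero    = refl
  A-zero (suc n) = partitionSeries-zero distinctEven? n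

  A-odd : ∀ k → ¬ Even (suc k) → A (suc k) ≈ A k ⊕ shift (suc k) (A (suc k))
  A-odd k odd = partitionSeries-headFree distinctEven? k (λ _ → distinctEven-∷-odd odd)

  A-even : ∀ k → Even (suc k) → A (suc k) ≈ A k ⊕ shift (suc k) (A k)
  A-even k even = ≈-trans (partitionSeries-step distinctEven? k)
    (⊕-cong (≈-refl {A k}) (shift-cong (suc k) without-suc-k))
    where
    fresh? : Decidable (λ ps → count (suc k) ps ≡ 0 × DistinctEven ps)
    fresh? ps = (count (suc k) ps ≟ 0) ×-dec distinctEven? ps
    without-suc-k : partitionSeries (distinctEven? ∘ (suc k ∷_)) (suc k) ≈ A k
    without-suc-k = begin
      partitionSeries (distinctEven? ∘ (suc k ∷_)) (suc k)
        ≈⟨ partitionSeries-≐ _ fresh? (suc k) (λ _ _ → distinctEven-∷-even even) ⟩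
      partitionSeries fresh? (suc k)
        ≈⟨ partitionSeries-headExcluded fresh? k
             (λ ps (none , _) → ℕₚ.0≢1+n (trans (sym none) (count-here (suc k) ps))) ⟩
      partitionSeries fresh? k
        ≈⟨ partitionSeries-≐ fresh? distinctEven? k (λ _ ps≤k → mk⇔ proj₂ (count-absent ps≤k ,_)) ⟩
      A k ∎
      where open ≈-Reasoning

  G-zero : G 0 ≈ δ
  G-zero zero    = refl
  G-zero (suc n) = partitionSeries-zero goodParts? n

  G-good : ∀ k → GoodPart (suc k) → G (suc k) ≈ G k ⊕ shift (suc k) (G (suc k))
  G-good k good = partitionSeries-headFree goodParts? k (λ _ → mk⇔ All.tail (good ∷_))

  G-bad : ∀ k → ¬ GoodPart (suc k) → G (suc k) ≈ G k
  G-bad k bad = partitionSeries-headExcluded goodParts? k (λ _ → bad ∘ All.head)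

  D-zero : D 0 ≈ 0ₛ
  D-zero zero    = refl
  D-zero (suc n) = partitionSeries-zero isDE2? n

  D-even : ∀ k → Even (suc k) → D (suc k) ≈ D k
  D-even k even = partitionSeries-headExcluded isDE2? k (λ _ (_ , odd , _) → odd even)

  D-odd : ∀ k → ¬ Even (suc k) → D (suc k) ≈ D k ⊕ shift (suc k ℕ.+ suc k) (A (suc k))
  D-odd k odd = ≈-trans (partitionSeries-step isDE2? k)
    (⊕-cong (≈-refl {D k}) (≈-trans (shift-cong (suc k) with-suc-k) (shift-+ (suc k) (suc k) (A (suc k)))))
    where
    again? : Decidable (λ ps → 1 ≤ count (suc k) ps × DistinctEven ps)
    again? ps = (1 ≤? count (suc k) ps) ×-dec distinctEven? ps
    with-suc-k : partitionSeries (isDE2? ∘ (suc k ∷_)) (suc k) ≈ shift (suc k) (A (suc k))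
    with-suc-k = begin
      partitionSeries (isDE2? ∘ (suc k ∷_)) (suc k)
        ≈⟨ partitionSeries-≐ _ again? (suc k) (λ _ _ → isDE2-∷-odd odd) ⟩
      partitionSeries again? (suc k)
        ≈⟨ partitionSeries-step again? k ⟩
      partitionSeries again? k ⊕ shift (suc k) (partitionSeries (again? ∘ (suc k ∷_)) (suc k))
        ≈⟨ ⊕-cong (partitionSeries-none again? k
                     (λ _ ps≤k (once , _) → ℕₚ.<⇒≱ once (ℕₚ.≤-reflexive (count-absent ps≤k))))
                  (shift-cong (suc k) (partitionSeries-≐ _ distinctEven? (suc k) (λ _ _ → occurs-∷-odd odd))) ⟩
      0ₛ ⊕ shift (suc k) (A (suc k))
        ≈⟨ (λ n → ℤₚ.+-identityˡ _) ⟩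
      shift (suc k) (A (suc k)) ∎
      where open ≈-Reasoning

  D-large : ∀ {K n} → n ≤ K → D K n ≡ + DE2 n
  D-large n≤K = cong (λ ps → + countBy isDE2? ps) (partitions≤-large n≤K)

  G-large : ∀ {K n} → n ≤ K → G K n ≡ + P-gt1-not4 n
  G-large n≤K = cong (λ ps → + countBy goodParts? ps) (partitions≤-large n≤K)

  shift₃D-large : ∀ {K} n → n ≤ K → shift 3 (D K) n ≡ + DE2-sub3 n
  shift₃D-large {K} n n≤K with n ℕ.<? 3
  ... | yes n<3 = shift-below 3 (D K) n<3
  ... | no  n≮3 = trans (shift-above 3 (D K) (ℕₚ.≮⇒≥ n≮3)) (D-large (ℕₚ.≤-trans (ℕₚ.m∸n≤m n 3) n≤K))

module DE2Identity where
  open import Data.Nat using (_≤_; _<_)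
  open import Data.Integer using (_+_)
  import Data.Integer.Properties as ℤₚ
  open import Relation.Binary.PropositionalEquality
  open PowerSeries
  open Arithmetic using (double; quad)
  open Products using (oneMinusQ)
  open Recurrences
  open GeneratingFunctions A A-zero A-odd A-even
  open Euler G G-zero G-good G-bad
  open Telescoping D D-zero D-odd D-even

  D⊕shift₃D≈G : ∀ j n → 0 < n → n ≤ suc (quad j) → let K = suc (quad j) in (D K ⊕ shift 3 (D K)) n ≡ G K n
  D⊕shift₃D≈G j (suc n) _ n≤K = begin
    D K (suc n) + shift 3 (D K) (suc n)
      ≡⟨ cong (_+ shift 3 (D K) (suc n)) (ℤₚ.+-identityˡ (D K (suc n))) ⟨
    (δ ⊕ D K ⊕ shift 3 (D K)) (suc n)              ≡⟨ telescoping (double j) (suc n) ⟨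
    tele K (A K) (suc n)                           ≡⟨ tele-low K (A K) (suc n) n≤K ⟩
    oneMinusQ 1 (A K) (suc n)                      ≡⟨ oneMinusQ-A≈G j (suc n) n≤K ⟩
    G K (suc n)                                    ∎
    where
    open ≡-Reasoning
    K = suc (quad j)

open import Defs
open import Data.Nat using (_+_; _<_; s≤s; z≤n)
import Data.Integer as ℤ
import Data.Integer.Properties as ℤₚ
open import Relation.Binary.PropositionalEquality
open Arithmetic using (quad; n≤quad)
open Recurrences using (D; G; D-large; G-large; shift₃D-large)
open DE2Identity using (D⊕shift₃D≈G)

corollary2p6 : (n : ℕ) → 0 < n → DE2 n + DE2-sub3 n ≡ P-gt1-not4 n
corollary2p6 (suc n) _ = ℤₚ.+-injective (begin
  ℤ.+ DE2 (suc n) ℤ.+ ℤ.+ DE2-sub3 (suc n)  ≡⟨ cong₂ ℤ._+_ (D-large 1+n≤K) (shift₃D-large (suc n) 1+n≤K) ⟨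
  (D K ⊕ shift 3 (D K)) (suc n)            ≡⟨ D⊕shift₃D≈G n (suc n) (s≤s z≤n) 1+n≤K ⟩
  G K (suc n)                              ≡⟨ G-large 1+n≤K ⟩
  ℤ.+ P-gt1-not4 (suc n)                   ∎)
  where
  open ≡-Reasoning
  K = suc (quad n)
  1+n≤K = s≤s (n≤quad n)
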